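{- If $r\ge 2$, then $\mathrm{gcover_e}(C_{2r}\,\square\, C_{2r})=\mathrm{gpart_e}(C_{2r}\,\square\, C_{2r})=4r$.
   Context: $C_n$ is the cycle on $n$ vertices and $G\,\square\, H$ is the Cartesian product (vertex set $V(G)\times V(H)$, with $(g,h)\sim(g',h')$ iff either $gg'\in E(G)$ and $h=h'$, or $g=g'$ and $hh'\in E(H)$). A geodesic is a shortest path. $\mathrm{gcover_e}(G)$ is the minimum number of geodesics of $G$ such that every edge lies on at least one of them; $\mathrm{gpart_e}(G)$ is the minimum number of geodesics of $G$ such that every edge lies on exactly one of them. -}

module Defs where

open import Level using (0ℓ)
open import Data.Nat using (ℕ; zero; suc; _≤_)
open import Data.Fin using (Fin; toℕ)
open import Data.Product using (Σ; _×_; _,_; ∃-syntax)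
open import Data.Sum using (_⊎_)
open import Data.Empty using (⊥)
open import Relation.Binary.PropositionalEquality using (_≡_)

record Graph : Set₁ where
  field
    V   : Set
    Adj : V → V → Set
open Graph public

CycSucc : (n : ℕ) → Fin n → Fin n → Set
CycSucc n i j = (toℕ j ≡ suc (toℕ i)) ⊎ ((suc (toℕ i) ≡ n) × (toℕ j ≡ 0))

Cycle : ℕ → Graph
Cycle n = record { V = Fin n ; Adj = λ i j → CycSucc n i j ⊎ CycSucc n j i }

_□_ : Graph → Graph → Graph
G □ H = record
  { V   = V G × V H
  ; Adj = λ { (g , h) (g' , h') → (Adj G g g' × h ≡ h') ⊎ (g ≡ g' × Adj H h h') } }

data Walk (G : Graph) : V G → V G → Set where
  [_]  : (v : V G) → Walk G v v
  step : (u : V G) {v w : V G} → Adj G u v → Walk G v w → Walk G u w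

len : {G : Graph} {u w : V G} → Walk G u w → ℕ
len [ v ]          = zero
len (step u a p)   = suc (len p)

OnWalk : {G : Graph} {u w : V G} → Walk G u w → V G → V G → Set
OnWalk [ v ] x y = ⊥
OnWalk (step u {v} a p) x y = ((x ≡ u × y ≡ v) ⊎ (x ≡ v × y ≡ u)) ⊎ OnWalk p x y

record Geodesic (G : Graph) : Set where
  field
    start end : V G
    walk      : Walk G start end
    shortest  : (q : Walk G start end) → len walk ≤ len q
open Geodesic public

IsEdgeGeodesicCover : (G : Graph) (k : ℕ) → (Fin k → Geodesic G) → Set
IsEdgeGeodesicCover G k P =
  (x y : V G) → Adj G x y → ∃[ i ] OnWalk (walk (P i)) x y

IsEdgeGeodesicPartition : (G : Graph) (k : ℕ) → (Fin k → Geodesic G) → Set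
IsEdgeGeodesicPartition G k P =
  (x y : V G) → Adj G x y →
    ∃[ i ] (OnWalk (walk (P i)) x y × ((j : Fin k) → OnWalk (walk (P j)) x y → j ≡ i))

IsLeast : (ℕ → Set) → ℕ → Set
IsLeast Q m = Q m × ((k : ℕ) → Q k → m ≤ k)

GcoverE≡ : Graph → ℕ → Set
GcoverE≡ G m = IsLeast (λ k → Σ (Fin k → Geodesic G) (IsEdgeGeodesicCover G k)) m

GpartE≡ : Graph → ℕ → Set
GpartE≡ G m = IsLeast (λ k → Σ (Fin k → Geodesic G) (IsEdgeGeodesicPartition G k)) m

-- Lower bound: with n = 2r the torus C_n □ C_n has 2n² edges and diameter n, and a geodesic
-- of length at most n traverses at most n edges, so fewer than 2n = 4r geodesics cannot cover
-- all edges.  Upper bound: the staircase from (a , b) that alternates r steps right with r steps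
-- up ends at the antipode (a + r , b + r) and has length 2r, so it is a geodesic (each coordinate
-- of any walk there travels half way round its cycle).  The 4r staircases starting at (a , 0)
-- and at (a , r) traverse every edge exactly once: an edge at height w = s r + j (j < r) lies on
-- the staircase starting at height s r, at its step j.

module Submission where

open import Defs
open import Data.Nat using (ℕ; _≤_; _*_)
open import Data.Product using (_×_)

open import Data.Nat using (zero; suc; _+_; _∸_; _<_; _%_; NonZero; >-nonZero; z≤n; s≤s; _≤?_; _<?_)
open import Data.Nat.Properties
open import Data.Nat.DivMod using (_mod_; m%n%n≡m%n; %-distribˡ-+; [m+n]%n≡m%n; m<n⇒m%n≡m; n%n≡0; m%n<n)
open import Data.Nat.Solver using (module +-*-Solver)
open import Data.Fin using (Fin; toℕ; fromℕ<; combine; remQuot)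
import Data.Fin as Fin
open import Data.Fin.Patterns using (0F; 1F)
open import Data.Fin.Properties
  using (toℕ-injective; toℕ<n; toℕ-fromℕ<; toℕ-combine; combine-injective; combine-remQuot; injective⇒≤; *↔×)
open import Data.Product using (Σ; ∃-syntax; _,_; proj₁; proj₂; swap)
open import Data.Product.Properties using (,-injective)
open import Data.Sum using (_⊎_; inj₁; inj₂)
import Data.Sum as Sum
open import Data.Empty using (⊥-elim)
open import Function.Base using (_∘_)
open import Function.Bundles using (_↔_; Inverse)
open import Function.Definitions using (Injective)
open import Relation.Binary.PropositionalEquality
open import Relation.Nullary using (yes; no)

SameEdge : {A : Set} → A × A → A × A → Set
SameEdge e e' = e ≡ e' ⊎ e ≡ swap e'

SameEdge-sym : {A : Set} {e e' : A × A} → SameEdge e e' → SameEdge e' e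
SameEdge-sym (inj₁ refl) = inj₁ refl
SameEdge-sym (inj₂ refl) = inj₂ refl

SameEdge-trans : {A : Set} {e e' e″ : A × A} → SameEdge e e' → SameEdge e' e″ → SameEdge e e″
SameEdge-trans (inj₁ refl) s = s
SameEdge-trans (inj₂ refl) (inj₁ refl) = inj₂ refl
SameEdge-trans (inj₂ refl) (inj₂ refl) = inj₁ refl

module _ {G : Graph} where

  _++ʷ_ : ∀ {u v w} → Walk G u v → Walk G v w → Walk G u w
  [ _ ] ++ʷ q = q
  step u a p ++ʷ q = step u a (p ++ʷ q)

  len-++ : ∀ {u v w} (p : Walk G u v) (q : Walk G v w) → len (p ++ʷ q) ≡ len p + len q
  len-++ [ _ ] q = refl
  len-++ (step u a p) q = cong suc (len-++ p q)

  reverse : (∀ {x y} → Adj G x y → Adj G y x) → ∀ {u w} → Walk G u w → Walk G w u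
  reverse sym-adj [ v ] = [ v ]
  reverse sym-adj (step u {v} a p) = reverse sym-adj p ++ʷ step v (sym-adj a) [ u ]

  len-reverse : (sym-adj : ∀ {x y} → Adj G x y → Adj G y x) →
                ∀ {u w} (p : Walk G u w) → len (reverse sym-adj p) ≡ len p
  len-reverse sym-adj [ v ] = refl
  len-reverse sym-adj (step u {v} a p) = begin
    len (reverse sym-adj p ++ʷ step v (sym-adj a) [ u ]) ≡⟨ len-++ (reverse sym-adj p) _ ⟩
    len (reverse sym-adj p) + 1                           ≡⟨ cong (_+ 1) (len-reverse sym-adj p) ⟩
    len p + 1                                             ≡⟨ +-comm (len p) 1 ⟩
    suc (len p)                                           ∎
    where open ≡-Reasoning

  OnWalk-sym : ∀ {u w} (p : Walk G u w) {x y} → OnWalk p x y → OnWalk p y x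
  OnWalk-sym (step u a p) (inj₁ (inj₁ (refl , refl))) = inj₁ (inj₂ (refl , refl))
  OnWalk-sym (step u a p) (inj₁ (inj₂ (refl , refl))) = inj₁ (inj₁ (refl , refl))
  OnWalk-sym (step u a p) (inj₂ o) = inj₂ (OnWalk-sym p o)

  OnWalk-resp-SameEdge : ∀ {u w} (p : Walk G u w) {e e' : V G × V G} → SameEdge e e' →
                         OnWalk p (proj₁ e') (proj₂ e') → OnWalk p (proj₁ e) (proj₂ e)
  OnWalk-resp-SameEdge p (inj₁ refl) o = o
  OnWalk-resp-SameEdge p (inj₂ refl) o = OnWalk-sym p o

  edgeAt : ∀ {u w} → Walk G u w → ℕ → V G × V G
  edgeAt [ v ] _ = v , v
  edgeAt (step u {v} _ p) zero = u , v
  edgeAt (step _ _ p) (suc i) = edgeAt p i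

  OnWalk⇒edgeAt : ∀ {u w} (p : Walk G u w) {x y} → OnWalk p x y →
                  ∃[ i ] i < len p × SameEdge (x , y) (edgeAt p i)
  OnWalk⇒edgeAt (step u a p) (inj₁ (inj₁ (refl , refl))) = 0 , s≤s z≤n , inj₁ refl
  OnWalk⇒edgeAt (step u a p) (inj₁ (inj₂ (refl , refl))) = 0 , s≤s z≤n , inj₂ refl
  OnWalk⇒edgeAt (step u a p) (inj₂ o) =
    let i , i<len , same = OnWalk⇒edgeAt p o in suc i , s≤s i<len , same

  geodesic-len≤ : ∀ {d} → (∀ x y → Σ (Walk G x y) λ p → len p ≤ d) →
                  (g : Geodesic G) → len (walk g) ≤ d
  geodesic-len≤ short g = let p , p≤d = short (start g) (end g) in ≤-trans (shortest g p) p≤d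

  partition⇒cover : ∀ {k} (P : Fin k → Geodesic G) →
                    IsEdgeGeodesicPartition G k P → IsEdgeGeodesicCover G k P
  partition⇒cover P part x y a = let i , o , _ = part x y a in i , o

  EdgePartitionBy : {I : Set} → (I → Geodesic G) → Set
  EdgePartitionBy {I} P = (x y : V G) → Adj G x y →
    ∃[ i ] (OnWalk (walk (P i)) x y × ((j : I) → OnWalk (walk (P j)) x y → j ≡ i))

  EdgePartitionBy-reindex : {I J : Set} (e : J ↔ I) (P : I → Geodesic G) →
                            EdgePartitionBy P → EdgePartitionBy (P ∘ Inverse.to e)
  EdgePartitionBy-reindex e P part x y a =
    let i , on-i , only-i = part x y a in
    Inverse.from e i ,
    subst (λ i' → OnWalk (walk (P i')) x y) (sym (Inverse.strictlyInverseˡ e i)) on-i ,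
    λ j on-j → trans (sym (Inverse.strictlyInverseʳ e j))
                     (cong (Inverse.from e) (only-i (Inverse.to e j) on-j))

  -- Sending an edge to (a geodesic covering it, its position there) is injective.
  cover-size-bound : ∀ {m d k} (e : Fin m → V G × V G) →
    (∀ i → Adj G (proj₁ (e i)) (proj₂ (e i))) → (∀ i j → SameEdge (e i) (e j) → i ≡ j) →
    (∀ g → len (walk g) ≤ d) →
    (P : Fin k → Geodesic G) → IsEdgeGeodesicCover G k P → m ≤ k * d
  cover-size-bound {m} {d} {k} e adj distinct short P cover = injective⇒≤ slot-injective
    where
    owner : Fin m → Fin k
    owner i = proj₁ (cover _ _ (adj i))

    located : ∀ i → ∃[ t ] t < len (walk (P (owner i))) × SameEdge (e i) (edgeAt (walk (P (owner i))) t)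
    located i = OnWalk⇒edgeAt _ (proj₂ (cover _ _ (adj i)))

    position : Fin m → ℕ
    position i = proj₁ (located i)

    position<d : ∀ i → position i < d
    position<d i = ≤-trans (proj₁ (proj₂ (located i))) (short (P (owner i)))

    slot : Fin m → Fin (k * d)
    slot i = combine (owner i) (fromℕ< (position<d i))

    slot-injective : Injective _≡_ _≡_ slot
    slot-injective {i} {j} eq = distinct i j (SameEdge-trans (proj₂ (proj₂ (located i)))
      (subst (λ z → SameEdge z (e j)) (sym same-edge) (SameEdge-sym (proj₂ (proj₂ (located j))))))
      where
      same-slot : owner i ≡ owner j × fromℕ< (position<d i) ≡ fromℕ< (position<d j)
      same-slot = combine-injective (owner i) _ (owner j) _ eq

      same-owner : owner i ≡ owner j
      same-owner = proj₁ same-slot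

      same-position : position i ≡ position j
      same-position = begin
        position i                       ≡⟨ toℕ-fromℕ< (position<d i) ⟨
        toℕ (fromℕ< (position<d i))      ≡⟨ cong toℕ (proj₂ same-slot) ⟩
        toℕ (fromℕ< (position<d j))      ≡⟨ toℕ-fromℕ< (position<d j) ⟩
        position j                       ∎
        where open ≡-Reasoning

      same-edge : edgeAt (walk (P (owner i))) (position i) ≡ edgeAt (walk (P (owner j))) (position j)
      same-edge = cong₂ (λ o t → edgeAt (walk (P o)) t) same-owner same-position

module _ {G H : Graph} where

  walkˡ : ∀ {g g'} → Walk G g g' → ∀ h → Walk (G □ H) (g , h) (g' , h)
  walkˡ [ g ] h = [ g , h ]
  walkˡ (step g a p) h = step (g , h) (inj₁ (a , refl)) (walkˡ p h)

  walkʳ : ∀ g {h h'} → Walk H h h' → Walk (G □ H) (g , h) (g , h')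
  walkʳ g [ h ] = [ g , h ]
  walkʳ g (step h b q) = step (g , h) (inj₂ (refl , b)) (walkʳ g q)

  len-walkˡ : ∀ {g g'} (p : Walk G g g') h → len (walkˡ p h) ≡ len p
  len-walkˡ [ _ ] h = refl
  len-walkˡ (step _ _ p) h = cong suc (len-walkˡ p h)

  len-walkʳ : ∀ g {h h'} (q : Walk H h h') → len (walkʳ g q) ≡ len q
  len-walkʳ g [ _ ] = refl
  len-walkʳ g (step _ _ q) = cong suc (len-walkʳ g q)

  □-walk≤ : ∀ {dG dH} → (∀ g g' → Σ (Walk G g g') λ p → len p ≤ dG) →
            (∀ h h' → Σ (Walk H h h') λ q → len q ≤ dH) →
            ∀ x y → Σ (Walk (G □ H) x y) λ p → len p ≤ dG + dH
  □-walk≤ shortG shortH (g , h) (g' , h') =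
    let p , p≤ = shortG g g'
        q , q≤ = shortH h h'
    in walkˡ p h ++ʷ walkʳ g' q ,
       subst (_≤ _) (sym (trans (len-++ (walkˡ p h) (walkʳ g' q))
                                (cong₂ _+_ (len-walkˡ p h) (len-walkʳ g' q))))
         (+-mono-≤ p≤ q≤)

  projectˡ : ∀ {g h g' h'} → Walk (G □ H) (g , h) (g' , h') → Walk G g g'
  projectˡ [ _ ] = [ _ ]
  projectˡ (step _ {_ , _} (inj₁ (a , refl)) p) = step _ a (projectˡ p)
  projectˡ (step _ {_ , _} (inj₂ (refl , _)) p) = projectˡ p

  projectʳ : ∀ {g h g' h'} → Walk (G □ H) (g , h) (g' , h') → Walk H h h'
  projectʳ [ _ ] = [ _ ]
  projectʳ (step _ {_ , _} (inj₁ (_ , refl)) p) = projectʳ p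
  projectʳ (step _ {_ , _} (inj₂ (refl , b)) p) = step _ b (projectʳ p)

  len-project : ∀ {g h g' h'} (p : Walk (G □ H) (g , h) (g' , h')) →
                len p ≡ len (projectˡ p) + len (projectʳ p)
  len-project [ _ ] = refl
  len-project (step _ {_ , _} (inj₁ (a , refl)) p) = cong suc (len-project p)
  len-project (step _ {_ , _} (inj₂ (refl , b)) p) =
    trans (cong suc (len-project p)) (sym (+-suc (len (projectˡ p)) (len (projectʳ p))))

module Modular (n : ℕ) .{{_ : NonZero n}} where

  infix 4 _≡ₘ_
  _≡ₘ_ : ℕ → ℕ → Set
  a ≡ₘ b = a % n ≡ b % n

  ≡⇒≡ₘ : ∀ {a b} → a ≡ b → a ≡ₘ b
  ≡⇒≡ₘ = cong (_% n)

  %-≡ₘ : ∀ a → a % n ≡ₘ a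
  %-≡ₘ a = m%n%n≡m%n a n

  n+-≡ₘ : ∀ a → n + a ≡ₘ a
  n+-≡ₘ a = trans (≡⇒≡ₘ (+-comm n a)) ([m+n]%n≡m%n a n)

  +-congʳ-≡ₘ : ∀ {a b} → a ≡ₘ b → ∀ k → a + k ≡ₘ b + k
  +-congʳ-≡ₘ {a} {b} a≡b k = begin
    (a + k) % n                ≡⟨ %-distribˡ-+ a k n ⟩
    (a % n + k % n) % n        ≡⟨ cong (λ z → (z + k % n) % n) a≡b ⟩
    (b % n + k % n) % n        ≡⟨ %-distribˡ-+ b k n ⟨
    (b + k) % n                ∎
    where open ≡-Reasoning

  +-congˡ-≡ₘ : ∀ k {a b} → a ≡ₘ b → k + a ≡ₘ k + b
  +-congˡ-≡ₘ k {a} {b} a≡b =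
    trans (≡⇒≡ₘ (+-comm k a)) (trans (+-congʳ-≡ₘ a≡b k) (≡⇒≡ₘ (+-comm b k)))

  -- Adding n ∸ (k % n) undoes adding k.
  +-cancelˡ-≡ₘ : ∀ k {a b} → k + a ≡ₘ k + b → a ≡ₘ b
  +-cancelˡ-≡ₘ k {a} {b} eq = begin
    a % n                           ≡⟨ n+-≡ₘ a ⟨
    (n + a) % n                     ≡⟨ ≡⇒≡ₘ (undo a) ⟨
    (n ∸ k % n + (k % n + a)) % n   ≡⟨ +-congˡ-≡ₘ (n ∸ k % n) reduced ⟩
    (n ∸ k % n + (k % n + b)) % n   ≡⟨ ≡⇒≡ₘ (undo b) ⟩
    (n + b) % n                     ≡⟨ n+-≡ₘ b ⟩
    b % n                           ∎
    where
    open ≡-Reasoning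
    undo : ∀ z → n ∸ k % n + (k % n + z) ≡ n + z
    undo z = trans (sym (+-assoc (n ∸ k % n) (k % n) z)) (cong (_+ z) (m∸n+n≡m (<⇒≤ (m%n<n k n))))
    reduced : k % n + a ≡ₘ k % n + b
    reduced = trans (+-congʳ-≡ₘ (%-≡ₘ k) a) (trans eq (sym (+-congʳ-≡ₘ (%-≡ₘ k) b)))

  +-cancelʳ-≡ₘ : ∀ k {a b} → a + k ≡ₘ b + k → a ≡ₘ b
  +-cancelʳ-≡ₘ k {a} {b} eq =
    +-cancelˡ-≡ₘ k (trans (≡⇒≡ₘ (+-comm k a)) (trans eq (≡⇒≡ₘ (+-comm b k))))

  ≡ₘ⇒≡ : ∀ {a b} → a < n → b < n → a ≡ₘ b → a ≡ b
  ≡ₘ⇒≡ a<n b<n eq = trans (sym (m<n⇒m%n≡m a<n)) (trans eq (m<n⇒m%n≡m b<n))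

module CycleGraph (n : ℕ) .{{_ : NonZero n}} where

  open Modular n public

  toℕ-injectiveₘ : ∀ {i j : Fin n} → toℕ i ≡ₘ toℕ j → i ≡ j
  toℕ-injectiveₘ {i} {j} eq = toℕ-injective (≡ₘ⇒≡ (toℕ<n i) (toℕ<n j) eq)

  next : Fin n → Fin n
  next i = suc (toℕ i) mod n

  toℕ-next : ∀ i → toℕ (next i) ≡ₘ suc (toℕ i)
  toℕ-next i = trans (≡⇒≡ₘ (toℕ-fromℕ< _)) (%-≡ₘ _)

  rotate : ℕ → Fin n → Fin n
  rotate zero i = i
  rotate (suc k) i = rotate k (next i)

  toℕ-rotate : ∀ k i → toℕ (rotate k i) ≡ₘ toℕ i + k
  toℕ-rotate zero i = ≡⇒≡ₘ (sym (+-identityʳ _))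
  toℕ-rotate (suc k) i = trans (toℕ-rotate k (next i))
    (trans (+-congʳ-≡ₘ (toℕ-next i) k) (≡⇒≡ₘ (sym (+-suc (toℕ i) k))))

  rotate-+ : ∀ a b i → rotate a (rotate b i) ≡ rotate (b + a) i
  rotate-+ a zero i = refl
  rotate-+ a (suc b) i = rotate-+ a b (next i)

  rotate-n : ∀ i → rotate n i ≡ i
  rotate-n i = toℕ-injectiveₘ
    (trans (toℕ-rotate n i) (trans (≡⇒≡ₘ (+-comm (toℕ i) n)) (n+-≡ₘ (toℕ i))))

  rotate-inverse : ∀ {k} → k ≤ n → ∀ i → rotate k (rotate (n ∸ k) i) ≡ i
  rotate-inverse {k} k≤n i = begin
    rotate k (rotate (n ∸ k) i)   ≡⟨ rotate-+ k (n ∸ k) i ⟩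
    rotate (n ∸ k + k) i          ≡⟨ cong (λ m → rotate m i) (m∸n+n≡m k≤n) ⟩
    rotate n i                    ≡⟨ rotate-n i ⟩
    i                             ∎
    where open ≡-Reasoning

  rotate-injective : ∀ k {i j} → rotate k i ≡ rotate k j → i ≡ j
  rotate-injective k {i} {j} eq = toℕ-injectiveₘ
    (+-cancelʳ-≡ₘ k (trans (sym (toℕ-rotate k i)) (trans (≡⇒≡ₘ (cong toℕ eq)) (toℕ-rotate k j))))

  rotate-fixpoint-free : ∀ {k} → 0 < k → k < n → ∀ i → rotate k i ≢ i
  rotate-fixpoint-free {k} 0<k k<n i eq = <⇒≢ 0<k (sym (≡ₘ⇒≡ k<n 0<n (+-cancelˡ-≡ₘ (toℕ i) i+k≡i+0)))
    where
    0<n : 0 < n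
    0<n = <-≤-trans 0<k (<⇒≤ k<n)

    i+k≡i+0 : toℕ i + k ≡ₘ toℕ i + 0
    i+k≡i+0 = trans (sym (toℕ-rotate k i)) (trans (≡⇒≡ₘ (cong toℕ eq)) (≡⇒≡ₘ (sym (+-identityʳ _))))

  CycSucc⇒≡ₘ : ∀ {i j} → CycSucc n i j → toℕ j ≡ₘ suc (toℕ i)
  CycSucc⇒≡ₘ (inj₁ eq) = ≡⇒≡ₘ eq
  CycSucc⇒≡ₘ {i} {j} (inj₂ (last , j≡0)) = begin
    toℕ j % n        ≡⟨ ≡⇒≡ₘ j≡0 ⟩
    0 % n            ≡⟨ n+-≡ₘ 0 ⟨
    (n + 0) % n      ≡⟨ ≡⇒≡ₘ (trans (+-identityʳ n) (sym last)) ⟩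
    suc (toℕ i) % n  ∎
    where open ≡-Reasoning

  CycSucc-next : ∀ i → CycSucc n i (next i)
  CycSucc-next i with suc (toℕ i) <? n
  ... | yes i+1<n = inj₁ (≡ₘ⇒≡ (toℕ<n (next i)) i+1<n (toℕ-next i))
  ... | no  i+1≮n = inj₂ (i+1≡n , trans (toℕ-fromℕ< _) (trans (cong (_% n) i+1≡n) (n%n≡0 n)))
    where
    i+1≡n : suc (toℕ i) ≡ n
    i+1≡n = ≤∧≮⇒≡ (toℕ<n i) i+1≮n

  CycSucc⇒next : ∀ {i j} → CycSucc n i j → j ≡ next i
  CycSucc⇒next {i} s = toℕ-injectiveₘ (trans (CycSucc⇒≡ₘ s) (sym (toℕ-next i)))

  Cycle-sym : ∀ {i j} → Adj (Cycle n) i j → Adj (Cycle n) j i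
  Cycle-sym = Sum.swap

  rotation-walk : ∀ k {i j} → rotate k i ≡ j → Σ (Walk (Cycle n) i j) λ p → len p ≡ k
  rotation-walk zero refl = [ _ ] , refl
  rotation-walk (suc k) {i} eq =
    let p , len-p = rotation-walk k eq in step i (inj₁ (CycSucc-next i)) p , cong suc len-p

  gap : Fin n → Fin n → ℕ
  gap i j = (n ∸ toℕ i + toℕ j) % n

  rotate-gap : ∀ i j → rotate (gap i j) i ≡ j
  rotate-gap i j = toℕ-injectiveₘ (begin
    toℕ (rotate (gap i j) i) % n          ≡⟨ toℕ-rotate (gap i j) i ⟩
    (toℕ i + gap i j) % n                 ≡⟨ +-congˡ-≡ₘ (toℕ i) (%-≡ₘ _) ⟩
    (toℕ i + (n ∸ toℕ i + toℕ j)) % n     ≡⟨ ≡⇒≡ₘ (+-assoc (toℕ i) _ (toℕ j)) ⟨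
    (toℕ i + (n ∸ toℕ i) + toℕ j) % n     ≡⟨ ≡⇒≡ₘ (cong (_+ toℕ j) (m+[n∸m]≡n (<⇒≤ (toℕ<n i)))) ⟩
    (n + toℕ j) % n                       ≡⟨ n+-≡ₘ (toℕ j) ⟩
    toℕ j % n                             ∎)
    where open ≡-Reasoning

  cycle-walk≤ : ∀ {d} → n ≤ d + d → ∀ i j → Σ (Walk (Cycle n) i j) λ p → len p ≤ d
  cycle-walk≤ {d} n≤d+d i j with gap i j ≤? d
  ... | yes g≤d =
    let p , len-p = rotation-walk (gap i j) (rotate-gap i j) in p , subst (_≤ d) (sym len-p) g≤d
  ... | no  g≰d =
    let p , len-p = rotation-walk (n ∸ gap i j) back in
    reverse Cycle-sym p , subst (_≤ d) (sym (trans (len-reverse Cycle-sym p) len-p)) n∸g≤d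
    where
    g≤n : gap i j ≤ n
    g≤n = <⇒≤ (m%n<n _ n)

    back : rotate (n ∸ gap i j) j ≡ i
    back = begin
      rotate (n ∸ gap i j) j                        ≡⟨ cong (rotate (n ∸ gap i j)) (rotate-gap i j) ⟨
      rotate (n ∸ gap i j) (rotate (gap i j) i)     ≡⟨ rotate-+ _ (gap i j) i ⟩
      rotate (gap i j + (n ∸ gap i j)) i            ≡⟨ cong (λ k → rotate k i) (m+[n∸m]≡n g≤n) ⟩
      rotate n i                                    ≡⟨ rotate-n i ⟩
      i                                             ∎
      where open ≡-Reasoning

    n∸g≤d : n ∸ gap i j ≤ d
    n∸g≤d = m≤n+o⇒m∸n≤o n (gap i j) (≤-trans n≤d+d (+-monoˡ-≤ d (<⇒≤ (≰⇒> g≰d))))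

  -- f counts the forward steps of a walk and b the backward ones.
  walk-winding : ∀ {i j} (p : Walk (Cycle n) i j) →
    Σ ℕ λ f → Σ ℕ λ b → len p ≡ f + b × toℕ i + f ≡ₘ toℕ j + b
  walk-winding [ _ ] = 0 , 0 , refl , refl
  walk-winding (step i (inj₁ s) p) =
    let f , b , len-p , winding = walk-winding p in
    suc f , b , cong suc len-p ,
    trans (≡⇒≡ₘ (+-suc (toℕ i) f)) (trans (+-congʳ-≡ₘ (sym (CycSucc⇒≡ₘ s)) f) winding)
  walk-winding {j = j} (step i (inj₂ s) p) =
    let f , b , len-p , winding = walk-winding p in
    f , suc b , trans (cong suc len-p) (sym (+-suc f b)) ,
    trans (+-congʳ-≡ₘ (CycSucc⇒≡ₘ s) f)
      (trans (+-congˡ-≡ₘ 1 winding) (≡⇒≡ₘ (sym (+-suc (toℕ j) b))))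

  winding-bound : ∀ {r f b} → r + r ≤ n → f ≡ₘ r + b → r ≤ f + b
  winding-bound {r} {f} {b} 2r≤n f≡r+b with f <? n | r + b <? n
  ... | yes f<n | yes r+b<n =
    ≤-trans (m≤m+n r b) (≤-trans (≤-reflexive (sym (≡ₘ⇒≡ f<n r+b<n f≡r+b))) (m≤m+n f b))
  ... | no  f≮n | _         = ≤-trans (≤-trans (m≤m+n r r) (≤-trans 2r≤n (≮⇒≥ f≮n))) (m≤m+n f b)
  ... | yes _   | no r+b≮n  = ≤-trans (+-cancelˡ-≤ r r b (≤-trans 2r≤n (≮⇒≥ r+b≮n))) (m≤n+m b f)

  rotation-len≥ : ∀ {r} → r + r ≤ n → ∀ {i} (p : Walk (Cycle n) i (rotate r i)) → r ≤ len p
  rotation-len≥ {r} 2r≤n {i} p =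
    let f , b , len-p , winding = walk-winding p in
    subst (r ≤_) (sym len-p) (winding-bound 2r≤n (+-cancelˡ-≡ₘ (toℕ i)
      (trans winding (trans (+-congʳ-≡ₘ (toℕ-rotate r i) b) (≡⇒≡ₘ (+-assoc (toℕ i) r b))))))

module Torus (r : ℕ) (2≤r : 2 ≤ r) where

  n : ℕ
  n = 2 * r

  n≡r+r : n ≡ r + r
  n≡r+r = cong (r +_) (+-identityʳ r)

  0<r : 0 < r
  0<r = <-≤-trans (s≤s z≤n) 2≤r

  r≤n : r ≤ n
  r≤n = m≤m+n r (r + 0)

  2<n : 2 < n
  2<n = +-mono-≤ 2≤r (≤-trans 0<r (m≤m+n r 0))

  instance
    n-nonZero : NonZero n
    n-nonZero = >-nonZero (<-≤-trans 0<r r≤n)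

  open CycleGraph n

  T : Graph
  T = Cycle n □ Cycle n

  geodesic-len≤n : (g : Geodesic T) → len (walk g) ≤ n
  geodesic-len≤n g = subst (len (walk g) ≤_) (sym n≡r+r)
    (geodesic-len≤ (□-walk≤ (cycle-walk≤ {r} n≤r+r) (cycle-walk≤ {r} n≤r+r)) g)
    where
    n≤r+r : n ≤ r + r
    n≤r+r = ≤-reflexive n≡r+r

  horizontal : ∀ a b → Adj T (a , b) (next a , b)
  horizontal a b = inj₁ (inj₁ (CycSucc-next a) , refl)

  vertical : ∀ a b → Adj T (a , b) (a , next b)
  vertical a b = inj₂ (refl , inj₁ (CycSucc-next b))

  Edge : Set
  Edge = (Fin n × Fin n) × Fin 2

  ends : Edge → (Fin n × Fin n) × (Fin n × Fin n)
  ends ((a , b) , 0F) = (a , b) , (next a , b)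
  ends ((a , b) , 1F) = (a , b) , (a , next b)

  ends-adjacent : ∀ ε → Adj T (proj₁ (ends ε)) (proj₂ (ends ε))
  ends-adjacent ((a , b) , 0F) = horizontal a b
  ends-adjacent ((a , b) , 1F) = vertical a b

  ends-complete : ∀ {x y} → Adj T x y → Σ Edge λ ε → SameEdge (x , y) (ends ε)
  ends-complete {a , b} (inj₁ (inj₁ s , refl)) =
    ((a , b) , 0F) , inj₁ (cong (λ c → (a , b) , (c , b)) (CycSucc⇒next s))
  ends-complete {_ , b} {c , _} (inj₁ (inj₂ s , refl)) =
    ((c , b) , 0F) , inj₂ (cong (λ a → (a , b) , (c , b)) (CycSucc⇒next s))
  ends-complete {a , b} (inj₂ (refl , inj₁ s)) =
    ((a , b) , 1F) , inj₁ (cong (λ d → (a , b) , (a , d)) (CycSucc⇒next s))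
  ends-complete {a , _} {_ , d} (inj₂ (refl , inj₂ s)) =
    ((a , d) , 1F) , inj₂ (cong (λ b → (a , b) , (a , d)) (CycSucc⇒next s))

  next-≢ : ∀ a → next a ≢ a
  next-≢ = rotate-fixpoint-free (s≤s z≤n) (<-trans (s≤s (s≤s z≤n)) 2<n)

  next²-≢ : ∀ a → next (next a) ≢ a
  next²-≢ = rotate-fixpoint-free (s≤s z≤n) 2<n

  ≡-coordinates : ∀ {a b c d a' b' c' d' : Fin n} → ((a , b) , (c , d)) ≡ ((a' , b') , (c' , d')) →
                a ≡ a' × b ≡ b' × c ≡ c' × d ≡ d'
  ≡-coordinates refl = refl , refl , refl , refl

  ends-injective : ∀ ε ε' → SameEdge (ends ε) (ends ε') → ε ≡ ε'
  ends-injective (_ , 0F) (_ , 0F) (inj₁ refl) = refl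
  ends-injective (_ , 1F) (_ , 1F) (inj₁ refl) = refl
  ends-injective (_ , 0F) (_ , 1F) (inj₁ e) with ≡-coordinates e
  ... | refl , _ , loop , _ = ⊥-elim (next-≢ _ loop)
  ends-injective (_ , 1F) (_ , 0F) (inj₁ e) with ≡-coordinates e
  ... | refl , _ , loop , _ = ⊥-elim (next-≢ _ (sym loop))
  ends-injective (_ , 0F) (_ , 0F) (inj₂ e) with ≡-coordinates e
  ... | refl , _ , loop , _ = ⊥-elim (next²-≢ _ loop)
  ends-injective (_ , 0F) (_ , 1F) (inj₂ e) with ≡-coordinates e
  ... | refl , _ , loop , _ = ⊥-elim (next-≢ _ loop)
  ends-injective (_ , 1F) (_ , 0F) (inj₂ e) with ≡-coordinates e
  ... | loop , _ , refl , _ = ⊥-elim (next-≢ _ (sym loop))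
  ends-injective (_ , 1F) (_ , 1F) (inj₂ e) with ≡-coordinates e
  ... | _ , refl , _ , loop = ⊥-elim (next²-≢ _ loop)

  edgeOf : Fin (n * n * 2) → Edge
  edgeOf i = let ab , t = remQuot {n * n} 2 i in remQuot {n} n ab , t

  edgeOf-injective : Injective _≡_ _≡_ edgeOf
  edgeOf-injective {i} {j} eq = trans (sym (code-edgeOf i)) (trans (cong code eq) (code-edgeOf j))
    where
    code : Edge → Fin (n * n * 2)
    code ((a , b) , t) = combine (combine a b) t

    code-edgeOf : ∀ i → code (edgeOf i) ≡ i
    code-edgeOf i = trans (cong (λ ab → combine ab (proj₂ (remQuot {n * n} 2 i))) (combine-remQuot {n} n _))
                          (combine-remQuot {n * n} 2 i)

  cover-size≥ : ∀ {k} (P : Fin k → Geodesic T) → IsEdgeGeodesicCover T k P → 4 * r ≤ k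
  cover-size≥ {k} P cover = *-cancelʳ-≤ (4 * r) k n (subst (_≤ k * n) edge-count
    (cover-size-bound (ends ∘ edgeOf) (ends-adjacent ∘ edgeOf)
      (λ i j same → edgeOf-injective (ends-injective _ _ same)) geodesic-len≤n P cover))
    where
    open +-*-Solver
    edge-count : n * n * 2 ≡ 4 * r * n
    edge-count = solve 1 (λ r → (con 2 :* r) :* (con 2 :* r) :* con 2 := con 4 :* r :* (con 2 :* r)) refl r

  staircase : ∀ k a b → Walk T (a , b) (rotate k a , rotate k b)
  staircase zero a b = [ a , b ]
  staircase (suc k) a b =
    step (a , b) (horizontal a b) (step (next a , b) (vertical (next a) b) (staircase k (next a) (next b)))

  len-staircase : ∀ k a b → len (staircase k a b) ≡ k + k
  len-staircase zero a b = refl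
  len-staircase (suc k) a b = cong suc (trans (cong suc (len-staircase k (next a) (next b))) (sym (+-suc k k)))

  -- Each coordinate of a walk from (a , b) to (rotate r a , rotate r b) moves to the antipode.
  staircase-shortest : ∀ a b (q : Walk T (a , b) (rotate r a , rotate r b)) → len (staircase r a b) ≤ len q
  staircase-shortest a b q = subst₂ _≤_ (sym (len-staircase r a b)) (sym (len-project q))
    (+-mono-≤ (rotation-len≥ {r} r+r≤n (projectˡ q)) (rotation-len≥ {r} r+r≤n (projectʳ q)))
    where
    r+r≤n : r + r ≤ n
    r+r≤n = ≤-reflexive (sym n≡r+r)

  staircaseGeodesic : Fin n → Fin n → Geodesic T
  staircaseGeodesic a b = record
    { start = a , b ; end = rotate r a , rotate r b
    ; walk = staircase r a b ; shortest = staircase-shortest a b }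

  -- Step j of a staircase from (a , b) traverses the edge right from (a + j , b + j), then the
  -- edge up from (a + j + 1 , b + j).
  stairEdge : ∀ {k} → Fin n → Fin n → Fin k → Fin 2 → Edge
  stairEdge a b j t = (rotate (toℕ j + toℕ t) a , rotate (toℕ j) b) , t

  Traverses : ∀ {u w} → Walk T u w → Edge → Set
  Traverses p ε = OnWalk p (proj₁ (ends ε)) (proj₂ (ends ε))

  staircase-edges⁺ : ∀ k a b (j : Fin k) t → Traverses (staircase k a b) (stairEdge a b j t)
  staircase-edges⁺ (suc k) a b 0F 0F = inj₁ (inj₁ (refl , refl))
  staircase-edges⁺ (suc k) a b 0F 1F = inj₂ (inj₁ (inj₁ (refl , refl)))
  staircase-edges⁺ (suc k) a b (Fin.suc j) t = inj₂ (inj₂ (staircase-edges⁺ k (next a) (next b) j t))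

  staircase-edges⁻ : ∀ k a b {x y} → OnWalk (staircase k a b) x y →
                     Σ (Fin k) λ j → Σ (Fin 2) λ t → SameEdge (x , y) (ends (stairEdge a b j t))
  staircase-edges⁻ (suc k) a b (inj₁ (inj₁ (refl , refl))) = 0F , 0F , inj₁ refl
  staircase-edges⁻ (suc k) a b (inj₁ (inj₂ (refl , refl))) = 0F , 0F , inj₂ refl
  staircase-edges⁻ (suc k) a b (inj₂ (inj₁ (inj₁ (refl , refl)))) = 0F , 1F , inj₁ refl
  staircase-edges⁻ (suc k) a b (inj₂ (inj₁ (inj₂ (refl , refl)))) = 0F , 1F , inj₂ refl
  staircase-edges⁻ (suc k) a b (inj₂ (inj₂ o)) =
    let j , t , same = staircase-edges⁻ k (next a) (next b) o in Fin.suc j , t , same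

  base : Fin r
  base = fromℕ< 0<r

  stairStart : Fin 2 → Fin n
  stairStart s = combine s base

  rotate-stairStart : ∀ s (j : Fin r) → rotate (toℕ j) (stairStart s) ≡ combine s j
  rotate-stairStart s j = toℕ-injectiveₘ (begin
    toℕ (rotate (toℕ j) (stairStart s)) % n   ≡⟨ toℕ-rotate (toℕ j) (stairStart s) ⟩
    (toℕ (combine s base) + toℕ j) % n        ≡⟨ ≡⇒≡ₘ (cong (_+ toℕ j) (toℕ-combine s base)) ⟩
    (r * toℕ s + toℕ base + toℕ j) % n        ≡⟨ ≡⇒≡ₘ (cong (λ z → r * toℕ s + z + toℕ j) base≡0) ⟩
    (r * toℕ s + 0 + toℕ j) % n               ≡⟨ ≡⇒≡ₘ (cong (_+ toℕ j) (+-identityʳ _)) ⟩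
    (r * toℕ s + toℕ j) % n                   ≡⟨ ≡⇒≡ₘ (toℕ-combine s j) ⟨
    toℕ (combine s j) % n                     ∎)
    where
    open ≡-Reasoning
    base≡0 : toℕ base ≡ 0
    base≡0 = toℕ-fromℕ< 0<r

  staircases : Fin n × Fin 2 → Geodesic T
  staircases (a , s) = staircaseGeodesic a (stairStart s)

  stairEdge-offset≤n : ∀ (j : Fin r) (t : Fin 2) → toℕ j + toℕ t ≤ n
  stairEdge-offset≤n j 0F = ≤-trans (≤-reflexive (+-identityʳ _)) (≤-trans (<⇒≤ (toℕ<n j)) r≤n)
  stairEdge-offset≤n j 1F = ≤-trans (≤-reflexive (+-comm (toℕ j) 1)) (≤-trans (toℕ<n j) r≤n)

  -- remQuot splits the height w of the edge as r * s + j with j < r.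
  stairEdge-owner : ∀ ε → Σ (Fin n × Fin 2) λ (a , s) → Σ (Fin r) λ j →
                    stairEdge a (stairStart s) j (proj₂ ε) ≡ ε
  stairEdge-owner ((u , w) , t) =
    let s , j = remQuot {2} r w in
    (rotate (n ∸ (toℕ j + toℕ t)) u , s) , j ,
    cong₂ (λ x y → (x , y) , t) (rotate-inverse {toℕ j + toℕ t} (stairEdge-offset≤n j t) u)
                                (trans (rotate-stairStart s j) (combine-remQuot {2} r w))

  stairEdge-injective : ∀ {a a' : Fin n} {s s' t t' : Fin 2} {j j' : Fin r} →
    stairEdge a (stairStart s) j t ≡ stairEdge a' (stairStart s') j' t' → (a , s) ≡ (a' , s')
  stairEdge-injective {s = s} {s'} {t} {j = j} {j'} e with ,-injective e
  ... | e₁ , refl with ,-injective e₁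
  ... | first , second
    with combine-injective s j s' j' (trans (sym (rotate-stairStart s j))
                                           (trans second (rotate-stairStart s' j')))
  ... | refl , refl = cong (_, s) (rotate-injective (toℕ j + toℕ t) first)

  staircases-partition : EdgePartitionBy staircases
  staircases-partition x y adj = (a , s) , on-staircase , only-staircase
    where
    ε = proj₁ (ends-complete adj)
    a = proj₁ (proj₁ (stairEdge-owner ε))
    s = proj₂ (proj₁ (stairEdge-owner ε))
    j = proj₁ (proj₂ (stairEdge-owner ε))

    owned : stairEdge a (stairStart s) j (proj₂ ε) ≡ ε
    owned = proj₂ (proj₂ (stairEdge-owner ε))

    on-staircase : OnWalk (staircase r a (stairStart s)) x y
    on-staircase = OnWalk-resp-SameEdge (staircase r a (stairStart s)) (proj₂ (ends-complete adj))
      (subst (Traverses (staircase r a (stairStart s))) owned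
        (staircase-edges⁺ r a (stairStart s) j (proj₂ ε)))

    only-staircase : ∀ ι → OnWalk (walk (staircases ι)) x y → ι ≡ (a , s)
    only-staircase (a' , s') on' =
      let j' , t' , same = staircase-edges⁻ r a' (stairStart s') on' in
      sym (stairEdge-injective {j = j} {j' = j'} (trans owned
        (ends-injective ε _ (SameEdge-trans (SameEdge-sym (proj₂ (ends-complete adj))) same))))

  staircase-partition : Σ (Fin (4 * r) → Geodesic T) (IsEdgeGeodesicPartition T (4 * r))
  staircase-partition = subst (λ k → Σ (Fin k → Geodesic T) (IsEdgeGeodesicPartition T k)) count
    (staircases ∘ Inverse.to index , EdgePartitionBy-reindex index staircases staircases-partition)
    where
    index : Fin (n * 2) ↔ (Fin n × Fin 2)
    index = *↔×

    count : n * 2 ≡ 4 * r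
    count = solve 1 (λ r → (con 2 :* r) :* con 2 := con 4 :* r) refl r
      where open +-*-Solver

proposition3p2 : (r : ℕ) → 2 ≤ r →
    GcoverE≡ (Cycle (2 * r) □ Cycle (2 * r)) (4 * r)
      × GpartE≡ (Cycle (2 * r) □ Cycle (2 * r)) (4 * r)
proposition3p2 r 2≤r =
  ((P , partition⇒cover P partition) , λ { _ (Q , cover) → cover-size≥ Q cover }) ,
  ((P , partition) , λ { _ (Q , partition′) → cover-size≥ Q (partition⇒cover Q partition′) })
  where open Torus r 2≤r
        P = proj₁ staircase-partition
        partition = proj₂ staircase-partition
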